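{- A connected graph $G$ is a caterpillar if and only if each closed walk $W$ on $G$ contains closed subwalks of length $2r$ for every integer $1\le r\le |W|/2$.
   Context: A walk is an alternating sequence of vertices and edges, each edge preceded and followed by its endpoints; its length $|W|$ is the number of edges counted with repetition; it is closed if first and last vertices coincide (closed walks differing only in initial vertex are identified). A subwalk of a closed walk $(v_0,\dots,v_r=v_0)$ is a walk $(v_i,v_{i+1},\dots,v_{i+\ell})$ of cyclically consecutive entries (indices mod $r$). A caterpillar is a tree which becomes a path on removal of its leaves. -}

module Defs where

open import Data.Nat using (ℕ; zero; suc; _+_; _*_; _≤_)
open import Data.Fin using (Fin; inject₁; fromℕ) renaming (zero to fzero; suc to fsuc)
open import Data.Bool using (Bool; T)
open import Data.List using (List; []; _∷_)
open import Data.List.Membership.Propositional using (_∈_)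
open import Data.List.Relation.Unary.Unique.Propositional using (Unique)
open import Data.Product using (Σ; ∃; _×_; _,_)
open import Data.Sum using (_⊎_)
open import Data.Empty using (⊥)
open import Relation.Nullary using (¬_)
open import Relation.Binary.PropositionalEquality using (_≡_)
open import Function.Bundles using (_⇔_)
open import Function.Definitions using (Injective)

record Graph (n : ℕ) : Set where
  field
    adj   : Fin n → Fin n → Bool
    sym   : ∀ u v → adj u v ≡ adj v u
    loopless : ∀ v → ¬ T (adj v v)

module _ {n : ℕ} (G : Graph n) where
  open Graph G

  Adj : Fin n → Fin n → Set
  Adj u v = T (adj u v)

  data Walk : Fin n → Fin n → Set where
    []  : ∀ {v} → Walk v v
    _∷_ : ∀ {u v w} → Adj u v → Walk v w → Walk u w

  Connected : Set
  Connected = ∀ u v → Walk u v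

  record Cycle : Set where
    field
      k     : ℕ
      c     : Fin (suc (suc (suc k))) → Fin n
      inj   : Injective _≡_ _≡_ c
      step  : ∀ (i : Fin (suc (suc k))) → Adj (c (inject₁ i)) (c (fsuc i))
      close : Adj (c (fromℕ (suc (suc k)))) (c fzero)

  Acyclic : Set
  Acyclic = ¬ Cycle

  Tree : Set
  Tree = Connected × Acyclic

  Leaf : Fin n → Set
  Leaf v = Σ (Fin n) λ u → Adj v u × (∀ w → Adj v w → w ≡ u)

  data Consec (x y : Fin n) : List (Fin n) → Set where
    here  : ∀ {zs} → Consec x y (x ∷ y ∷ zs)
    there : ∀ {z zs} → Consec x y zs → Consec x y (z ∷ zs)

  -- The subgraph induced on the vertex set S is a path: its vertices can be
  -- listed without repetition as p_0,...,p_m such that two vertices of S are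
  -- adjacent iff they are consecutive in the list.  (The empty list gives the
  -- null path, so e.g. K2 is a caterpillar.)
  InducedPath : (Fin n → Set) → Set
  InducedPath S = Σ (List (Fin n)) λ ps →
      Unique ps
    × (∀ v → (v ∈ ps) ⇔ S v)
    × (∀ x y → x ∈ ps → y ∈ ps → (Adj x y ⇔ (Consec x y ps ⊎ Consec y x ps)))

  Caterpillar : Set
  Caterpillar = Tree × InducedPath (λ v → ¬ Leaf v)

  -- A closed walk of length r, given by its periodic vertex sequence:
  -- w i is the vertex v_{i mod r} of the closed walk (v_0,...,v_r = v_0).
  -- The choice of initial vertex is irrelevant for the property below.
  record ClosedWalk : Set where
    field
      len  : ℕ
      w    : ℕ → Fin n
      periodic : ∀ i → w (i + len) ≡ w i
      step : ∀ i → Adj (w i) (w (suc i))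

  -- W contains a closed subwalk (v_i, ..., v_{i+ℓ}) (indices mod |W|) of length ℓ
  HasClosedSubwalk : ClosedWalk → ℕ → Set
  HasClosedSubwalk W ℓ = Σ ℕ λ i → ClosedWalk.w W i ≡ ClosedWalk.w W (i + ℓ)

  EvenClosedSubwalkProperty : Set
  EvenClosedSubwalkProperty = ∀ (W : ClosedWalk) (r : ℕ) → 1 ≤ r → 2 * r ≤ ClosedWalk.len W →
    HasClosedSubwalk W (2 * r)

module Submission where

-- If G is a caterpillar, let the level of a vertex be the index of the spine vertex it
-- is or hangs off, and 2-colour G.  On a closed walk (vᵢ), the vertices vᵢ and vᵢ₊₂ᵣ have
-- the same colour; if they always differ, then so do their levels (two vertices of
-- equal level and colour share their neighbours, forcing vᵢ₊₁ = vᵢ₊₁₊₂ᵣ), and the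
-- sign of the difference never flips.  But a periodic sequence cannot stay strictly
-- above its own shift.
--
-- Conversely, a cycle walked round once has no closed subwalk of length 2, and the
-- walk round a spider with three legs of length 2 has length 12 and no closed
-- subwalk of length 6.  So G is a tree, a maximal path of non-leaves has no chords,
-- and it contains every non-leaf: the first non-leaf off the path adjacent to it
-- would be the third leg of such a spider at an inner vertex of the path (its ends
-- being maximal).

open import Defs
open import Data.Bool using (Bool; false; not; T; T?)
open import Data.Bool.Properties using (not-involutive; not-¬)
open import Data.Empty using (⊥; ⊥-elim)
open import Data.Fin using (Fin; toℕ; fromℕ; inject₁) renaming (zero to fzero; suc to fsuc)
open import Data.Fin.Properties using (any?; all?; _≟_; toℕ-fromℕ; toℕ-injective; toℕ<n; injective⇒≤)
open import Data.List using (List; []; _∷_; _++_; [_]; length; tabulate)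
open import Data.List.Properties using (length-++; length-tabulate)
open import Data.List.Membership.Propositional using (_∈_; _∉_)
open import Data.List.Relation.Unary.All as All using (All; []; _∷_)
open import Data.List.Relation.Unary.All.Properties using (¬Any⇒All¬; ++⁺)
open import Data.List.Relation.Unary.Any using (here; there)
open import Data.List.Relation.Unary.Linked as Linked using (Linked; []; [-]; _∷_)
open import Data.List.Relation.Unary.Unique.Propositional using (Unique; []; _∷_)
open import Data.List.Relation.Unary.Unique.Propositional.Properties as Unique using (tabulate⁺)
open import Data.Nat using (ℕ; zero; suc; _+_; _∸_; _*_; _≤_; _<_; z≤n; s≤s; s≤s⁻¹; _%_; _/_; NonZero; >-nonZero; _<?_)
open import Data.Nat.DivMod using (m≡m%n+[m/n]*n; m%n<n; %-pred-≡0; [1+m%d]≤1+n⇒[m%d]≤n; m<[1+n%d]⇒m≤[n%d]; %-distribˡ-+; m<n⇒m%n≡m; m≤n⇒[n∸m]%m≡n%m; [m+n]%n≡m%n)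
open import Data.Nat.Properties hiding (_≟_)
open import Data.Product using (Σ; ∃; ∃₂; _×_; _,_; proj₁; proj₂)
open import Data.Sum as Sum using (_⊎_; inj₁; inj₂)
open import Function using (_∘_; _$_)
open import Function.Bundles using (_⇔_; mk⇔; Equivalence)
open import Relation.Binary.Core using (Rel)
open import Relation.Binary.Definitions using (Transitive; Irreflexive; tri<; tri≈; tri>)
open import Relation.Binary.PropositionalEquality using (_≡_; _≢_; refl; sym; trans; cong; subst; subst₂; module ≡-Reasoning)
open import Relation.Nullary using (¬_; Dec; yes; no; does)
open import Relation.Nullary.Decidable using (_×-dec_; _→-dec_; ¬?; map′; decidable-stable)

module _ {a} {A : Set a} {L : ℕ} (f : ℕ → A) (f-periodic : ∀ i → f (i + L) ≡ f i) where

  periodic-multiple : ∀ i q → f (i + q * L) ≡ f i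
  periodic-multiple i zero = cong f (+-identityʳ i)
  periodic-multiple i (suc q) = begin
    f (i + (L + q * L)) ≡⟨ cong f (trans (cong (i +_) (+-comm L (q * L))) (sym (+-assoc i (q * L) L))) ⟩
    f (i + q * L + L)   ≡⟨ f-periodic (i + q * L) ⟩
    f (i + q * L)       ≡⟨ periodic-multiple i q ⟩
    f i                 ∎
    where open ≡-Reasoning

  periodic-% : .{{_ : NonZero L}} → ∀ i → f i ≡ f (i % L)
  periodic-% i = trans (cong f (m≡m%n+[m/n]*n i L)) (periodic-multiple (i % L) (i / L))

  periodic-%-shift : .{{_ : NonZero L}} → ∀ i j → f (i + j) ≡ f (i % L + j)
  periodic-%-shift i j = begin
    f (i + j)                 ≡⟨ cong (λ m → f (m + j)) (m≡m%n+[m/n]*n i L) ⟩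
    f (i % L + i / L * L + j) ≡⟨ cong f (+-assoc (i % L) (i / L * L) j) ⟩
    f (i % L + (i / L * L + j)) ≡⟨ cong (λ m → f (i % L + m)) (+-comm (i / L * L) j) ⟩
    f (i % L + (j + i / L * L)) ≡⟨ cong f (sym (+-assoc (i % L) j (i / L * L))) ⟩
    f (i % L + j + i / L * L) ≡⟨ periodic-multiple (i % L + j) (i / L) ⟩
    f (i % L + j)             ∎
    where open ≡-Reasoning

periodic-not-ascending : ∀ {a ℓ} {A : Set a} {_≺_ : Rel A ℓ} → Transitive _≺_ → Irreflexive _≡_ _≺_ →
  ∀ {L} (f : ℕ → A) → (∀ i → f (i + L) ≡ f i) → 0 < L → ∀ k → ¬ (∀ i → f i ≺ f (i + k))
periodic-not-ascending {_≺_ = _≺_} ≺-trans ≺-irrefl {suc l} f f-periodic _ k ascending =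
  ≺-irrefl refl (subst (f 0 ≺_) full-turn (climb l))
  where
  climb : ∀ j → f 0 ≺ f (suc j * k)
  climb zero = subst (λ m → f 0 ≺ f m) (sym (+-identityʳ k)) (ascending 0)
  climb (suc j) = ≺-trans (climb j) (subst (λ m → f (suc j * k) ≺ f m) (+-comm (suc j * k) k) (ascending (suc j * k)))
  full-turn : f (suc l * k) ≡ f 0
  full-turn = trans (cong f (*-comm (suc l) k)) (periodic-multiple f f-periodic 0 k)

%-suc : ∀ i m .{{_ : NonZero m}} → (suc i % m ≡ 0 × i % m ≡ m ∸ 1) ⊎ suc i % m ≡ suc (i % m)
%-suc i m with suc i % m in eq
... | zero = inj₁ (refl , %-pred-≡0 eq)
... | suc r = inj₂ (cong suc (≤-antisym
        (m<[1+n%d]⇒m≤[n%d] i m (≤-reflexive (sym eq)))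
        ([1+m%d]≤1+n⇒[m%d]≤n i r m (subst (0 <_) (sym eq) (s≤s z≤n)) (≤-reflexive eq))))

%-shift-≢ : ∀ i {k m} .{{_ : NonZero m}} → 0 < k → k < m → i % m ≢ (i + k) % m
%-shift-≢ i {k} {m} 0<k k<m eq = remainder-shift-≢ (m%n<n i m) (trans eq shift)
  where
  shift : (i + k) % m ≡ (i % m + k) % m
  shift = trans (%-distribˡ-+ i k m) (cong (λ x → (i % m + x) % m) (m<n⇒m%n≡m k<m))
  remainder-shift-≢ : ∀ {j} → j < m → j ≢ (j + k) % m
  remainder-shift-≢ {j} j<m eq with j + k <? m
  ... | yes j+k<m = <⇒≢ (m<m+n j 0<k) (trans eq (m<n⇒m%n≡m j+k<m))
  ... | no j+k≮m = <⇒≢ k<m (sym (+-cancelˡ-≡ j m k (begin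
        j + m         ≡⟨ cong (_+ m) (trans eq (trans (sym (m≤n⇒[n∸m]%m≡n%m m≤j+k)) (m<n⇒m%n≡m j+k∸m<m))) ⟩
        j + k ∸ m + m ≡⟨ m∸n+n≡m m≤j+k ⟩
        j + k         ∎)))
    where
    open ≡-Reasoning
    m≤j+k : m ≤ j + k
    m≤j+k = ≮⇒≥ j+k≮m
    j+k∸m<m : j + k ∸ m < m
    j+k∸m<m = +-cancelʳ-< m _ m (subst (_< m + m) (sym (m∸n+n≡m m≤j+k)) (+-mono-< j<m k<m))

at : ∀ {a} {A : Set a} → A → List A → ℕ → A
at d [] _ = d
at d (x ∷ xs) zero = x
at d (x ∷ xs) (suc j) = at d xs j

module _ {a} {A : Set a} {d : A} where

  at-∈ : ∀ {xs} j → j < length xs → at d xs j ∈ xs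
  at-∈ {x ∷ xs} zero _ = here refl
  at-∈ {x ∷ xs} (suc j) j<len = there (at-∈ j (s≤s⁻¹ j<len))

  ∈⇒at : ∀ {x xs} → x ∈ xs → ∃ λ j → j < length xs × at d xs j ≡ x
  ∈⇒at (here refl) = zero , s≤s z≤n , refl
  ∈⇒at (there x∈) with ∈⇒at x∈
  ... | j , j<len , at-j = suc j , s≤s j<len , at-j

  at-injective : ∀ {xs} → Unique xs → ∀ {i j} → i < length xs → j < length xs → at d xs i ≡ at d xs j → i ≡ j
  at-injective {x ∷ xs} _ {zero} {zero} _ _ _ = refl
  at-injective {x ∷ xs} (x∉ ∷ _) {zero} {suc j} _ j<len x≡ = ⊥-elim (All.lookup x∉ (at-∈ j (s≤s⁻¹ j<len)) x≡)
  at-injective {x ∷ xs} (x∉ ∷ _) {suc i} {zero} i<len _ ≡x = ⊥-elim (All.lookup x∉ (at-∈ i (s≤s⁻¹ i<len)) (sym ≡x))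
  at-injective {x ∷ xs} (_ ∷ unique) {suc i} {suc j} i<len j<len same =
    cong suc (at-injective unique (s≤s⁻¹ i<len) (s≤s⁻¹ j<len) same)

  at-step : ∀ {ℓ} {R : Rel A ℓ} {xs} → Linked R xs → ∀ {j} → suc j < length xs → R (at d xs j) (at d xs (suc j))
  at-step (r ∷ _) {zero} _ = r
  at-step (_ ∷ linked) {suc j} j<len = at-step linked (s≤s⁻¹ j<len)
  at-step [-] (s≤s ())

  at-tabulate : ∀ {m} (f : Fin m → A) i → at d (tabulate f) (toℕ i) ≡ f i
  at-tabulate f fzero = refl
  at-tabulate f (fsuc i) = at-tabulate (f ∘ fsuc) i

Linked-tabulate : ∀ {a ℓ} {A : Set a} {R : Rel A ℓ} {m} (f : Fin (suc m) → A) →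
                  (∀ i → R (f (inject₁ i)) (f (fsuc i))) → Linked R (tabulate f)
Linked-tabulate {m = zero} f _ = [-]
Linked-tabulate {m = suc m} f steps = steps fzero ∷ Linked-tabulate (f ∘ fsuc) (steps ∘ fsuc)

lastOf : ∀ {a} {A : Set a} → A → List A → A
lastOf x [] = x
lastOf x (y ∷ ys) = lastOf y ys

module _ {a} {A : Set a} where

  length-snoc : ∀ (xs : List A) y → length (xs ++ [ y ]) ≡ suc (length xs)
  length-snoc xs y = trans (length-++ xs) (+-comm (length xs) 1)

  Linked-snoc : ∀ {ℓ} {R : Rel A ℓ} {x} {xs : List A} {y} →
                Linked R (x ∷ xs) → R (lastOf x xs) y → Linked R (x ∷ xs ++ [ y ])
  Linked-snoc {xs = []} [-] r = r ∷ [-]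
  Linked-snoc {xs = _ ∷ _} (r ∷ linked) r′ = r ∷ Linked-snoc linked r′

  Unique-snoc : ∀ {xs : List A} {y} → Unique xs → y ∉ xs → Unique (xs ++ [ y ])
  Unique-snoc {xs} {y} unique y∉ = Unique.++⁺ unique ([] ∷ []) disjoint
    where
    disjoint : ∀ {v} → v ∈ xs × v ∈ [ y ] → ⊥
    disjoint (y∈ , here refl) = y∉ y∈

index-of : ∀ {n} → Fin n → List (Fin n) → ℕ
index-of v [] = 0
index-of v (x ∷ xs) with v ≟ x
... | yes _ = 0
... | no _ = suc (index-of v xs)

index-of-head : ∀ {n} (x : Fin n) xs → index-of x (x ∷ xs) ≡ 0
index-of-head x xs with x ≟ x
... | yes _ = refl
... | no x≢x = ⊥-elim (x≢x refl)

index-of-skip : ∀ {n} {v x : Fin n} xs → v ≢ x → index-of v (x ∷ xs) ≡ suc (index-of v xs)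
index-of-skip {v = v} {x} xs v≢x with v ≟ x
... | yes v≡x = ⊥-elim (v≢x v≡x)
... | no _ = refl

index-of-injective : ∀ {n} {x y : Fin n} xs → x ∈ xs → y ∈ xs → index-of x xs ≡ index-of y xs → x ≡ y
index-of-injective {x = x} {y} (z ∷ zs) x∈ y∈ same with x ≟ z | y ≟ z
... | yes refl | yes refl = refl
... | yes _    | no _     = ⊥-elim (0≢1+n same)
... | no _     | yes _    = ⊥-elim (0≢1+n (sym same))
... | no x≢z   | no y≢z   = index-of-injective zs (drop-head x∈ x≢z) (drop-head y∈ y≢z) (suc-injective same)
  where
  drop-head : ∀ {v} → v ∈ z ∷ zs → v ≢ z → v ∈ zs
  drop-head (here v≡z) v≢z = ⊥-elim (v≢z v≡z)
  drop-head (there v∈) _ = v∈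

parity : ℕ → Bool
parity zero = false
parity (suc k) = not (parity k)

module _ {n : ℕ} (G : Graph n) where
  open import Data.List.Membership.DecPropositional (_≟_ {n}) using (_∈?_)
  open Graph G using (adj) renaming (sym to adj-sym)

  Adj-sym : ∀ {u v} → Adj G u v → Adj G v u
  Adj-sym {u} {v} = subst T (adj-sym u v)

  Adj? : ∀ u v → Dec (Adj G u v)
  Adj? u v = T? (adj u v)

  Leaf? : ∀ v → Dec (Leaf G v)
  Leaf? v = any? λ u → Adj? v u ×-dec all? λ w → Adj? v w →-dec w ≟ u

  non-leaf⇒other-neighbour : ∀ {v u} → ¬ Leaf G v → Adj G v u → ∃ λ w → Adj G v w × w ≢ u
  non-leaf⇒other-neighbour {v} {u} ¬leaf vu with any? (λ w → Adj? v w ×-dec ¬? (w ≟ u))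
  ... | yes found = found
  ... | no none = ⊥-elim (¬leaf (u , vu , λ w vw → decidable-stable (w ≟ u) λ w≢u → none (w , vw , w≢u)))

  adjacent-leaves-cover : Connected G → ∀ {x y} → Adj G x y → Leaf G x → Leaf G y → ∀ t → t ≡ x ⊎ t ≡ y
  adjacent-leaves-cover conn {x} {y} xy (_ , _ , x-only) (_ , _ , y-only) t = go (inj₁ refl) (conn x t)
    where
    go : ∀ {s t} → s ≡ x ⊎ s ≡ y → Walk G s t → t ≡ x ⊎ t ≡ y
    go s∈xy [] = s∈xy
    go (inj₁ refl) (xz ∷ walk) = go (inj₂ (trans (x-only _ xz) (sym (x-only y xy)))) walk
    go (inj₂ refl) (yz ∷ walk) = go (inj₁ (trans (y-only _ yz) (sym (y-only x (Adj-sym xy))))) walk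

  closed-subwalk? : (W : ClosedWalk G) → 0 < ClosedWalk.len W → ∀ ℓ → Dec (HasClosedSubwalk G W ℓ)
  closed-subwalk? W 0<len ℓ =
    map′ (λ (i , _ , closed) → i , closed) reduce (anyUpTo? (λ i → w i ≟ w (i + ℓ)) len)
    where
    open ClosedWalk W
    instance
      len≢0 : NonZero len
      len≢0 = >-nonZero 0<len
    reduce : HasClosedSubwalk G W ℓ → ∃ λ i → i < len × w i ≡ w (i + ℓ)
    reduce (i , closed) = i % len , m%n<n i len ,
      trans (sym (periodic-% w periodic i)) (trans closed (periodic-%-shift w periodic i ℓ))

  record Grading : Set where
    field
      level  : Fin n → ℕ
      colour : Fin n → Bool
      colour-alternates : ∀ {u v} → Adj G u v → colour v ≡ not (colour u)
      level-step : ∀ {u v} → Adj G u v → level v ≤ suc (level u)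
      ascent-parity : ∀ {u v} → Adj G u v → level v ≡ suc (level u) →
                      colour u ≡ parity (level u) × colour v ≡ parity (level v)
      twins-share-neighbour : ∀ {x y x′ y′} → level x ≡ level y → colour x ≡ colour y → x ≢ y →
                              Adj G x x′ → Adj G y y′ → x′ ≡ y′

  module _ (g : Grading) where
    open Grading g

    -- The inequalities force both edges to be ascents onto the same level,
    -- where ascent-parity gives x and y different colours.
    no-crossing : ∀ {x x′ y y′} → Adj G x x′ → Adj G y y′ → colour x ≡ colour y →
                  level x < level y → level y′ < level x′ → ⊥
    no-crossing {x} {x′} {y} {y′} xx′ yy′ same-colour x<y y′<x′ =
      not-¬ (proj₁ (ascent-parity xx′ x-ascends)) (trans same-colour y-colour)
      where
      x′≤ : level x′ ≤ suc (level x)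
      x′≤ = level-step xx′
      y≤ : level y ≤ suc (level y′)
      y≤ = level-step (Adj-sym yy′)
      x-ascends : level x′ ≡ suc (level x)
      x-ascends = ≤-antisym x′≤ (≤-trans x<y (≤-trans y≤ y′<x′))
      y-ascends : level y ≡ suc (level y′)
      y-ascends = ≤-antisym y≤ (≤-trans y′<x′ (≤-trans x′≤ x<y))
      y-colour : colour y ≡ not (parity (level x))
      y-colour = trans (proj₂ (ascent-parity (Adj-sym yy′) y-ascends))
                       (cong parity (≤-antisym (≤-trans y≤ (≤-trans y′<x′ x′≤)) x<y))

    module _ (W : ClosedWalk G) where
      open ClosedWalk W

      colour-even-shift : ∀ i r → colour (w (i + 2 * r)) ≡ colour (w i)
      colour-even-shift i zero = cong (colour ∘ w) (+-identityʳ i)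
      colour-even-shift i (suc r) = begin
        colour (w (i + 2 * suc r))          ≡⟨ cong (colour ∘ w) two-more ⟩
        colour (w (suc (suc (i + 2 * r))))  ≡⟨ colour-alternates (step (suc (i + 2 * r))) ⟩
        not (colour (w (suc (i + 2 * r))))  ≡⟨ cong not (colour-alternates (step (i + 2 * r))) ⟩
        not (not (colour (w (i + 2 * r))))  ≡⟨ not-involutive _ ⟩
        colour (w (i + 2 * r))              ≡⟨ colour-even-shift i r ⟩
        colour (w i)                        ∎
        where
        open ≡-Reasoning
        two-more : i + 2 * suc r ≡ suc (suc (i + 2 * r))
        two-more = trans (cong (i +_) (*-suc 2 r)) (trans (+-suc i _) (cong suc (+-suc i _)))

      module _ (r : ℕ) (no-subwalk : ∀ i → w i ≢ w (i + 2 * r)) where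

        level-gap : ∀ i → level (w i) ≢ level (w (i + 2 * r))
        level-gap i same-level = no-subwalk (suc i)
          (twins-share-neighbour same-level (sym (colour-even-shift i r)) (no-subwalk i) (step i) (step (i + 2 * r)))

        ascent-persists : ∀ i → level (w i) < level (w (i + 2 * r)) →
                          level (w (suc i)) < level (w (suc i + 2 * r))
        ascent-persists i up with <-cmp (level (w (suc i))) (level (w (suc i + 2 * r)))
        ... | tri< up′ _ _ = up′
        ... | tri≈ _ same _ = ⊥-elim (level-gap (suc i) same)
        ... | tri> _ _ down = ⊥-elim (no-crossing (step i) (step (i + 2 * r)) (sym (colour-even-shift i r)) up down)

        descent-persists : ∀ i → level (w (i + 2 * r)) < level (w i) →
                           level (w (suc i + 2 * r)) < level (w (suc i))
        descent-persists i down with <-cmp (level (w (suc i))) (level (w (suc i + 2 * r)))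
        ... | tri< up _ _ = ⊥-elim (no-crossing (step (i + 2 * r)) (step i) (colour-even-shift i r) down up)
        ... | tri≈ _ same _ = ⊥-elim (level-gap (suc i) same)
        ... | tri> _ _ down′ = down′

        no-nonempty-walk : ¬ 0 < len
        no-nonempty-walk 0<len with <-cmp (level (w 0)) (level (w (2 * r)))
        ... | tri< up _ _ =
          periodic-not-ascending <-trans <-irrefl (level ∘ w) (cong level ∘ periodic) 0<len (2 * r) ascending
          where
          ascending : ∀ i → level (w i) < level (w (i + 2 * r))
          ascending zero = up
          ascending (suc i) = ascent-persists i (ascending i)
        ... | tri≈ _ same _ = level-gap 0 same
        ... | tri> _ _ down =
          periodic-not-ascending (λ p q → <-trans q p) (<-irrefl ∘ sym) (level ∘ w) (cong level ∘ periodic) 0<len (2 * r) descending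
          where
          descending : ∀ i → level (w (i + 2 * r)) < level (w i)
          descending zero = down
          descending (suc i) = descent-persists i (descending i)

      has-even-closed-subwalks : 0 < len → ∀ r → HasClosedSubwalk G W (2 * r)
      has-even-closed-subwalks 0<len r = decidable-stable (closed-subwalk? W 0<len (2 * r))
        λ none → no-nonempty-walk r (λ i closed → none (i , closed)) 0<len

  Consec-head : ∀ {x y zs} → Consec G x y zs → x ∈ zs
  Consec-head here = here refl
  Consec-head (there c) = there (Consec-head c)

  Consec-next : ∀ {x y zs} → Consec G x y zs → y ∈ zs
  Consec-next here = there (here refl)
  Consec-next (there c) = there (Consec-next c)

  index-of-Consec : ∀ {x y ps} → Unique ps → Consec G x y ps → index-of y ps ≡ suc (index-of x ps)
  index-of-Consec {x} {y} ((x≢y All.∷ _) ∷ _) (here {zs}) = begin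
    index-of y (x ∷ y ∷ zs) ≡⟨ index-of-skip (y ∷ zs) (x≢y ∘ sym) ⟩
    suc (index-of y (y ∷ zs)) ≡⟨ cong suc (index-of-head y zs) ⟩
    1                         ≡⟨ cong suc (sym (index-of-head x (y ∷ zs))) ⟩
    suc (index-of x (x ∷ y ∷ zs)) ∎
    where open ≡-Reasoning
  index-of-Consec {x} {y} {z ∷ zs} (z∉zs ∷ unique) (there c) = begin
    index-of y (z ∷ zs)       ≡⟨ index-of-skip zs (λ y≡z → All.lookup z∉zs (Consec-next c) (sym y≡z)) ⟩
    suc (index-of y zs)       ≡⟨ cong suc (index-of-Consec unique c) ⟩
    suc (suc (index-of x zs)) ≡⟨ cong suc (sym (index-of-skip zs (λ x≡z → All.lookup z∉zs (Consec-head c) (sym x≡z)))) ⟩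
    suc (index-of x (z ∷ zs)) ∎
    where open ≡-Reasoning

  all-leaves-grading : Connected G → (∀ v → Leaf G v) → Fin n → Grading
  all-leaves-grading conn all-leaves v₀ = record
    { level = λ _ → 0
    ; colour = colour
    ; colour-alternates = alternates
    ; level-step = λ _ → z≤n
    ; ascent-parity = λ _ ()
    ; twins-share-neighbour = twins
    }
    where
    colour : Fin n → Bool
    colour v = does (v ≟ v₀)
    other-end-is-v₀ : ∀ {u v} → Adj G u v → u ≢ v₀ → v ≡ v₀
    other-end-is-v₀ uv u≢v₀ with adjacent-leaves-cover conn uv (all-leaves _) (all-leaves _) v₀
    ... | inj₁ v₀≡u = ⊥-elim (u≢v₀ (sym v₀≡u))
    ... | inj₂ v₀≡v = sym v₀≡v
    alternates : ∀ {u v} → Adj G u v → colour v ≡ not (colour u)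
    alternates {u} {v} uv with u ≟ v₀ | v ≟ v₀
    ... | yes refl | yes refl = ⊥-elim (Graph.loopless G u uv)
    ... | yes _ | no _ = refl
    ... | no _ | yes _ = refl
    ... | no u≢v₀ | no v≢v₀ = ⊥-elim (v≢v₀ (other-end-is-v₀ uv u≢v₀))
    twins : ∀ {x y x′ y′} → 0 ≡ 0 → colour x ≡ colour y → x ≢ y → Adj G x x′ → Adj G y y′ → x′ ≡ y′
    twins {x} {y} _ same-colour x≢y xx′ yy′ with x ≟ v₀ | y ≟ v₀
    ... | yes refl | yes refl = ⊥-elim (x≢y refl)
    ... | yes _ | no _ = ⊥-elim (not-¬ refl same-colour)
    ... | no _ | yes _ = ⊥-elim (not-¬ refl (sym same-colour))
    ... | no x≢v₀ | no y≢v₀ = trans (other-end-is-v₀ xx′ x≢v₀) (sym (other-end-is-v₀ yy′ y≢v₀))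

  non-member⇒leaf : ∀ {ps} → (∀ v → (v ∈ ps) ⇔ (¬ Leaf G v)) → ∀ {v} → v ∉ ps → Leaf G v
  non-member⇒leaf ps⇔ {v} v∉ = decidable-stable (Leaf? v) (v∉ ∘ Equivalence.from (ps⇔ v))

  module SpineGrading (conn : Connected G) (ps : List (Fin n)) (unique : Unique ps)
    (spine⇔ : ∀ v → (v ∈ ps) ⇔ (¬ Leaf G v))
    (spine-adj : ∀ x y → x ∈ ps → y ∈ ps → (Adj G x y ⇔ (Consec G x y ps ⊎ Consec G y x ps))) where

    index : Fin n → ℕ
    index v = index-of v ps

    data Position (v : Fin n) : Set where
      on-spine : v ∈ ps → Position v
      pendant  : ∀ {u} → u ∈ ps → Adj G v u → (∀ w → Adj G v w → w ≡ u) → Position v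

    position : ∀ {p₀} → p₀ ∈ ps → ∀ v → Position v
    position {p₀} p₀∈ v with v ∈? ps
    ... | yes v∈ = on-spine v∈
    ... | no v∉ with non-member⇒leaf spine⇔ v∉
    ...   | u , vu , only with u ∈? ps
    ...     | yes u∈ = pendant u∈ vu only
    ...     | no u∉ with adjacent-leaves-cover conn vu (u , vu , only) (non-member⇒leaf spine⇔ u∉) p₀
    ...       | inj₁ refl = ⊥-elim (v∉ p₀∈)
    ...       | inj₂ refl = ⊥-elim (u∉ p₀∈)

    level-at : ∀ {v} → Position v → ℕ
    level-at {v} (on-spine _) = index v
    level-at (pendant {u} _ _ _) = index u

    colour-at : ∀ {v} → Position v → Bool
    colour-at {v} (on-spine _) = parity (index v)
    colour-at (pendant {u} _ _ _) = not (parity (index u))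

    pendants-not-adjacent : ∀ {u v a b} → a ∈ ps → (∀ w → Adj G u w → w ≡ a) →
                            b ∈ ps → Adj G v b → (∀ w → Adj G v w → w ≡ b) → ¬ Adj G u v
    pendants-not-adjacent a∈ u-only b∈ vb v-only uv =
      Equivalence.to (spine⇔ _) (subst (_∈ ps) (sym (u-only _ uv)) a∈) (_ , vb , v-only)

    spine-step : ∀ {x y} → x ∈ ps → y ∈ ps → Adj G x y →
                 index y ≡ suc (index x) ⊎ index x ≡ suc (index y)
    spine-step x∈ y∈ xy with Equivalence.to (spine-adj _ _ x∈ y∈) xy
    ... | inj₁ x-y = inj₁ (index-of-Consec unique x-y)
    ... | inj₂ y-x = inj₂ (index-of-Consec unique y-x)

    colour-alternates-at : ∀ {u v} (pu : Position u) (pv : Position v) → Adj G u v → colour-at pv ≡ not (colour-at pu)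
    colour-alternates-at (on-spine u∈) (on-spine v∈) uv with spine-step u∈ v∈ uv
    ... | inj₁ up = cong parity up
    ... | inj₂ down = trans (sym (not-involutive _)) (cong not (sym (cong parity down)))
    colour-alternates-at (on-spine _) (pendant _ _ v-only) uv = cong (not ∘ parity ∘ index) (sym (v-only _ (Adj-sym uv)))
    colour-alternates-at (pendant _ _ u-only) (on-spine _) uv =
      trans (sym (not-involutive _)) (cong (not ∘ not ∘ parity ∘ index) (u-only _ uv))
    colour-alternates-at (pendant a∈ _ u-only) (pendant b∈ vb v-only) uv =
      ⊥-elim (pendants-not-adjacent a∈ u-only b∈ vb v-only uv)

    level-step-at : ∀ {u v} (pu : Position u) (pv : Position v) → Adj G u v → level-at pv ≤ suc (level-at pu)
    level-step-at (on-spine u∈) (on-spine v∈) uv with spine-step u∈ v∈ uv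
    ... | inj₁ up = ≤-reflexive up
    ... | inj₂ down = ≤-trans (n≤1+n _) (≤-trans (≤-reflexive (sym down)) (n≤1+n _))
    level-step-at (on-spine _) (pendant _ _ v-only) uv =
      ≤-trans (≤-reflexive (cong index (sym (v-only _ (Adj-sym uv))))) (n≤1+n _)
    level-step-at (pendant _ _ u-only) (on-spine _) uv = ≤-trans (≤-reflexive (cong index (u-only _ uv))) (n≤1+n _)
    level-step-at (pendant a∈ _ u-only) (pendant b∈ vb v-only) uv =
      ⊥-elim (pendants-not-adjacent a∈ u-only b∈ vb v-only uv)

    ascent-parity-at : ∀ {u v} (pu : Position u) (pv : Position v) → Adj G u v → level-at pv ≡ suc (level-at pu) →
                       colour-at pu ≡ parity (level-at pu) × colour-at pv ≡ parity (level-at pv)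
    ascent-parity-at (on-spine _) (on-spine _) _ _ = refl , refl
    ascent-parity-at (on-spine _) (pendant _ _ v-only) uv up =
      ⊥-elim (1+n≢n (sym (trans (cong index (v-only _ (Adj-sym uv))) up)))
    ascent-parity-at (pendant _ _ u-only) (on-spine _) uv up =
      ⊥-elim (1+n≢n (sym (trans (cong index (sym (u-only _ uv))) up)))
    ascent-parity-at (pendant a∈ _ u-only) (pendant b∈ vb v-only) uv =
      ⊥-elim (pendants-not-adjacent a∈ u-only b∈ vb v-only uv)

    twins-at : ∀ {x y x′ y′} (px : Position x) (py : Position y) → level-at px ≡ level-at py → colour-at px ≡ colour-at py →
               x ≢ y → Adj G x x′ → Adj G y y′ → x′ ≡ y′
    twins-at (on-spine x∈) (on-spine y∈) same-level _ x≢y _ _ = ⊥-elim (x≢y (index-of-injective ps x∈ y∈ same-level))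
    twins-at (on-spine x∈) (pendant b∈ _ _) same-level same-colour _ _ _ =
      ⊥-elim (not-¬ refl (trans (cong (parity ∘ index) (sym (index-of-injective ps x∈ b∈ same-level))) same-colour))
    twins-at (pendant a∈ _ _) (on-spine y∈) same-level same-colour _ _ _ =
      ⊥-elim (not-¬ refl (trans (cong (parity ∘ index) (sym (index-of-injective ps y∈ a∈ (sym same-level))))
                                (sym same-colour)))
    twins-at (pendant a∈ _ x-only) (pendant b∈ _ y-only) same-level _ _ xx′ yy′ =
      trans (x-only _ xx′) (trans (index-of-injective ps a∈ b∈ same-level) (sym (y-only _ yy′)))

    spine-grading : ∀ {p₀} → p₀ ∈ ps → Grading
    spine-grading p₀∈ = record
      { level = level-at ∘ place
      ; colour = colour-at ∘ place
      ; colour-alternates = λ {u} {v} → colour-alternates-at (place u) (place v)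
      ; level-step = λ {u} {v} → level-step-at (place u) (place v)
      ; ascent-parity = λ {u} {v} → ascent-parity-at (place u) (place v)
      ; twins-share-neighbour = λ {x} {y} → twins-at (place x) (place y)
      }
      where
      place : ∀ v → Position v
      place = position p₀∈

  caterpillar-grading : Connected G → Caterpillar G → Fin n → Grading
  caterpillar-grading conn (_ , [] , _ , spine⇔ , _) v₀ =
    all-leaves-grading conn (λ v → non-member⇒leaf spine⇔ λ ()) v₀
  caterpillar-grading conn (_ , p ∷ ps , unique , spine⇔ , spine-adj) _ =
    SpineGrading.spine-grading conn (p ∷ ps) unique spine⇔ spine-adj (here refl)

  caterpillar⇒even-closed-subwalks : Connected G → Caterpillar G → EvenClosedSubwalkProperty G
  caterpillar⇒even-closed-subwalks conn cat W r 1≤r 2r≤len =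
    has-even-closed-subwalks (caterpillar-grading conn cat (w 0)) W (≤-trans 1≤r (≤-trans (m≤m+n r _) 2r≤len)) r
    where open ClosedWalk W

  cyclic-walk : ∀ m .{{_ : NonZero m}} (f : ℕ → Fin n) → (∀ {j} → suc j < m → Adj G (f j) (f (suc j))) →
                Adj G (f (m ∸ 1)) (f 0) → ClosedWalk G
  cyclic-walk m f steps close = record
    { len = m ; w = f ∘ (_% m) ; periodic = λ i → cong f ([m+n]%n≡m%n i m) ; step = step }
    where
    step : ∀ i → Adj G (f (i % m)) (f (suc i % m))
    step i with %-suc i m
    ... | inj₁ (wraps , last) = subst₂ (λ u v → Adj G (f u) (f v)) (sym last) (sym wraps) close
    ... | inj₂ advances = subst (Adj G (f (i % m)) ∘ f) (sym advances) (steps (subst (_< m) advances (m%n<n (suc i) m)))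

  module _ (prop : EvenClosedSubwalkProperty G) where

    -- The chord closes the cycle y₀ … yⱼ, whose closed walk has no closed subwalk of length 2.
    no-chord : ∀ {d ys} → Unique ys → Linked (Adj G) ys → ∀ {j} → 2 ≤ j → j < length ys →
               ¬ Adj G (at d ys j) (at d ys 0)
    no-chord {d} {ys} unique linked {j} 2≤j j<len close =
      let i , closed = prop cycle 1 (s≤s z≤n) (m≤n⇒m≤1+n 2≤j)
      in %-shift-≢ i (s≤s z≤n) (s≤s 2≤j) (at-injective unique (below i) (below (i + 2)) closed)
      where
      m = suc j
      cycle = cyclic-walk m (at d ys) (λ sj<m → at-step linked (≤-trans sj<m j<len)) close
      below : ∀ k → k % m < length ys
      below k = ≤-trans (m%n<n k m) j<len

    acyclic : Acyclic G
    acyclic cycle = no-chord (tabulate⁺ inj) (Linked-tabulate c step) (s≤s (s≤s z≤n)) last<len closing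
      where
      open Cycle cycle
      last<len : suc (suc k) < length (tabulate c)
      last<len = subst (suc (suc k) <_) (sym (length-tabulate c)) ≤-refl
      closing : Adj G (at (c fzero) (tabulate c) (suc (suc k))) (c fzero)
      closing = subst (λ j → Adj G (at (c fzero) (tabulate c) j) (c fzero)) (toℕ-fromℕ (suc (suc k)))
                  (subst (λ v → Adj G v (c fzero)) (sym (at-tabulate c (fromℕ (suc (suc k))))) close)

    no-spider : ∀ {q a a′ b b′ c c′} → Adj G q a → Adj G q b → Adj G q c → Adj G a a′ → Adj G b b′ → Adj G c c′ →
                a ≢ b → a ≢ c → b ≢ c → a′ ≢ q → b′ ≢ q → c′ ≢ q → ⊥
    no-spider {q} {a} {a′} {b} {b′} {c} {c′} qa qb qc aa′ bb′ cc′ a≢b a≢c b≢c a′≢q b′≢q c′≢q =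
      let i , closed = prop spider 3 (s≤s z≤n) (s≤s (s≤s (s≤s (s≤s (s≤s (s≤s z≤n))))))
      in no-return i closed
      where
      g : ℕ → Fin n
      g 0 = q
      g 1 = a
      g 2 = a′
      g 3 = a
      g 4 = q
      g 5 = b
      g 6 = b′
      g 7 = b
      g 8 = q
      g 9 = c
      g 10 = c′
      g 11 = c
      g (suc (suc (suc (suc (suc (suc (suc (suc (suc (suc (suc (suc i)))))))))))) = g i

      g-step : ∀ i → Adj G (g i) (g (suc i))
      g-step 0 = qa
      g-step 1 = aa′
      g-step 2 = Adj-sym aa′
      g-step 3 = Adj-sym qa
      g-step 4 = qb
      g-step 5 = bb′
      g-step 6 = Adj-sym bb′
      g-step 7 = Adj-sym qb
      g-step 8 = qc
      g-step 9 = cc′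
      g-step 10 = Adj-sym cc′
      g-step 11 = Adj-sym qc
      g-step (suc (suc (suc (suc (suc (suc (suc (suc (suc (suc (suc (suc i)))))))))))) = g-step i

      spider : ClosedWalk G
      spider = record { len = 12 ; w = g ; periodic = λ i → cong g (+-comm i 12) ; step = g-step }

      no-return : ∀ i → g i ≢ g (i + 6)
      no-return 0 q≡b′ = b′≢q (sym q≡b′)
      no-return 1 = a≢b
      no-return 2 = a′≢q
      no-return 3 = a≢c
      no-return 4 q≡c′ = c′≢q (sym q≡c′)
      no-return 5 = b≢c
      no-return 6 = b′≢q
      no-return 7 b≡a = a≢b (sym b≡a)
      no-return 8 q≡a′ = a′≢q (sym q≡a′)
      no-return 9 c≡a = a≢c (sym c≡a)
      no-return 10 = c′≢q
      no-return 11 c≡b = b≢c (sym c≡b)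
      no-return (suc (suc (suc (suc (suc (suc (suc (suc (suc (suc (suc (suc i)))))))))))) = no-return i

    adjacent-to-head⇒next : ∀ {z zs y} → Unique (z ∷ zs) → Linked (Adj G) (z ∷ zs) → y ∈ zs → Adj G z y →
                            Consec G z y (z ∷ zs)
    adjacent-to-head⇒next _ _ (here refl) _ = here
    adjacent-to-head⇒next {z} {_ ∷ zs} unique linked (there y∈) zy with ∈⇒at {d = z} y∈
    ... | j , j<len , refl = ⊥-elim (no-chord unique linked (s≤s (s≤s z≤n)) (s≤s (s≤s j<len)) (Adj-sym zy))

    adjacent⇒consecutive : ∀ {ys x y} → Unique ys → Linked (Adj G) ys → x ∈ ys → y ∈ ys → Adj G x y →
                           Consec G x y ys ⊎ Consec G y x ys
    adjacent⇒consecutive _ _ (here refl) (here refl) xx = ⊥-elim (Graph.loopless G _ xx)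
    adjacent⇒consecutive unique linked (here refl) (there y∈) xy = inj₁ (adjacent-to-head⇒next unique linked y∈ xy)
    adjacent⇒consecutive unique linked (there x∈) (here refl) xy = inj₂ (adjacent-to-head⇒next unique linked x∈ (Adj-sym xy))
    adjacent⇒consecutive (_ ∷ unique) linked (there x∈) (there y∈) xy =
      Sum.map there there (adjacent⇒consecutive unique (Linked.tail linked) x∈ y∈ xy)

  consecutive⇒adjacent : ∀ {ys x y} → Linked (Adj G) ys → Consec G x y ys → Adj G x y
  consecutive⇒adjacent (xy ∷ _) here = xy
  consecutive⇒adjacent (_ ∷ linked) (there c) = consecutive⇒adjacent linked c

  Inner : Fin n → Set
  Inner v = ¬ Leaf G v

  record InnerPath : Set where
    constructor inner-path
    field
      first  : Fin n
      rest   : List (Fin n)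
      unique : Unique (first ∷ rest)
      linked : Linked (Adj G) (first ∷ rest)
      inner  : All Inner (first ∷ rest)

    vertices : List (Fin n)
    vertices = first ∷ rest

    last : Fin n
    last = lastOf first rest

  open InnerPath

  ClosedAt : Fin n → InnerPath → Set
  ClosedAt e P = ∀ y → Adj G e y → Inner y → y ∈ vertices P

  Maximal : InnerPath → Set
  Maximal P = ClosedAt (first P) P × ClosedAt (last P) P

  Extension : Fin n → InnerPath → Fin n → Set
  Extension e P y = Adj G e y × Inner y × y ∉ vertices P

  extension? : ∀ e P → Dec (∃ (Extension e P))
  extension? e P = any? λ y → Adj? e y ×-dec ¬? (Leaf? y) ×-dec ¬? (y ∈? vertices P)

  closed-at : ∀ {e P} → ¬ ∃ (Extension e P) → ClosedAt e P
  closed-at {P = P} no-extension y ey inner-y =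
    decidable-stable (y ∈? vertices P) λ y∉ → no-extension (y , ey , inner-y , y∉)

  length≤ : ∀ P → length (vertices P) ≤ n
  length≤ P = injective⇒≤ {f = at (first P) (vertices P) ∘ toℕ}
    λ same → toℕ-injective (at-injective (unique P) (toℕ<n _) (toℕ<n _) same)

  maximal-extension : ∀ fuel (P : InnerPath) → n < fuel + length (vertices P) → Σ InnerPath Maximal
  maximal-extension zero P n<len = ⊥-elim (<⇒≱ n<len (length≤ P))
  maximal-extension (suc fuel) P@(inner-path h rest unique linked inner) n< with extension? h P
  ... | yes (y , hy , inner-y , y∉) =
    maximal-extension fuel
      (inner-path y (h ∷ rest) (¬Any⇒All¬ _ y∉ ∷ unique) (Adj-sym hy ∷ linked) (inner-y ∷ inner))
      (subst (n <_) (sym (+-suc fuel _)) n<)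
  ... | no ¬head with extension? (lastOf h rest) P
  ...   | yes (y , ly , inner-y , y∉) =
    maximal-extension fuel
      (inner-path h (rest ++ [ y ]) (Unique-snoc unique y∉) (Linked-snoc linked ly) (++⁺ inner (inner-y ∷ [])))
      (subst (λ ℓ → n < fuel + suc ℓ) (sym (length-snoc rest y)) (subst (n <_) (sym (+-suc fuel _)) n<))
  ...   | no ¬last = P , closed-at {P = P} ¬head , closed-at {P = P} ¬last

  Interior : Fin n → List (Fin n) → Set
  Interior q xs = ∃₂ λ a b → a ≢ b × Adj G q a × Adj G q b × a ∈ xs × b ∈ xs

  second-vertex : ∀ x y ys → Unique (x ∷ y ∷ ys) → Linked (Adj G) (x ∷ y ∷ ys) →
                  y ≡ lastOf y ys ⊎ Interior y (x ∷ y ∷ ys)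
  second-vertex x y [] _ _ = inj₁ refl
  second-vertex x y (z ∷ zs) ((_ ∷ x≢z ∷ _) ∷ _) (xy ∷ yz ∷ _) =
    inj₂ (x , z , x≢z , Adj-sym xy , yz , here refl , there (there (here refl)))

  endpoint-or-interior : ∀ {q} x xs → Unique (x ∷ xs) → Linked (Adj G) (x ∷ xs) → q ∈ x ∷ xs →
                         q ≡ x ⊎ q ≡ lastOf x xs ⊎ Interior q (x ∷ xs)
  endpoint-or-interior x xs _ _ (here refl) = inj₁ refl
  endpoint-or-interior x (y ∷ ys) unique@(_ ∷ unique′) linked (there q∈)
    with endpoint-or-interior y ys unique′ (Linked.tail linked) q∈
  ... | inj₁ refl = inj₂ (second-vertex x y ys unique linked)
  ... | inj₂ (inj₁ last) = inj₂ (inj₁ last)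
  ... | inj₂ (inj₂ (a , b , a≢b , qa , qb , a∈ , b∈)) = inj₂ (inj₂ (a , b , a≢b , qa , qb , there a∈ , there b∈))

  -- A leaf entered from outside xs can only step back, so the walk enters xs from an inner vertex.
  entry-point : ∀ xs {v t} → Walk G v t → t ∈ xs → v ∉ xs → Inner v →
                ∃₂ λ z q → z ∉ xs × q ∈ xs × Adj G z q × Inner z
  entry-point xs {t = t} walk t∈ v∉ inner-v = go walk v∉ (inj₁ inner-v)
    where
    go : ∀ {v} → Walk G v t → v ∉ xs → Inner v ⊎ (∃ λ p → p ∉ xs × Adj G p v) →
         ∃₂ λ z q → z ∉ xs × q ∈ xs × Adj G z q × Inner z
    go [] v∉ _ = ⊥-elim (v∉ t∈)
    go {v} (_∷_ {v = x} vx walk) v∉ entered with x ∈? xs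
    ... | no x∉ = go walk x∉ (inj₂ (v , v∉ , vx))
    ... | yes x∈ = v , x , v∉ , x∈ , vx , entered-inner entered
      where
      entered-inner : Inner v ⊎ (∃ λ p → p ∉ xs × Adj G p v) → Inner v
      entered-inner (inj₁ inner-v) = inner-v
      entered-inner (inj₂ (p , p∉ , pv)) (_ , _ , only) =
        p∉ (subst (_∈ xs) (trans (only x vx) (sym (only p (Adj-sym pv)))) x∈)

  module _ (conn : Connected G) (prop : EvenClosedSubwalkProperty G) where

    maximal-covers : ∀ P → Maximal P → ∀ v → Inner v → v ∈ vertices P
    maximal-covers P (closed-first , closed-last) v inner-v with v ∈? vertices P
    ... | yes v∈ = v∈
    ... | no v∉ with entry-point (vertices P) (conn v (first P)) (here refl) v∉ inner-v
    ...   | z , q , z∉ , q∈ , zq , inner-z with endpoint-or-interior (first P) (rest P) (unique P) (linked P) q∈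
    ...     | inj₁ refl = ⊥-elim (z∉ (closed-first z (Adj-sym zq) inner-z))
    ...     | inj₂ (inj₁ refl) = ⊥-elim (z∉ (closed-last z (Adj-sym zq) inner-z))
    ...     | inj₂ (inj₂ (a , b , a≢b , qa , qb , a∈ , b∈)) =
      let a′ , aa′ , a′≢q = leg (All.lookup (inner P) a∈) qa
          b′ , bb′ , b′≢q = leg (All.lookup (inner P) b∈) qb
          z′ , zz′ , z′≢q = leg inner-z (Adj-sym zq)
      in ⊥-elim $ no-spider prop qa qb (Adj-sym zq) aa′ bb′ zz′ a≢b (≢z a∈) (≢z b∈) a′≢q b′≢q z′≢q
      where
      leg : ∀ {x} → Inner x → Adj G q x → ∃ λ x′ → Adj G x x′ × x′ ≢ q
      leg inner-x qx = non-leaf⇒other-neighbour inner-x (Adj-sym qx)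
      ≢z : ∀ {x} → x ∈ vertices P → x ≢ z
      ≢z x∈ x≡z = z∉ (subst (_∈ vertices P) x≡z x∈)

    inner-vertices-induce-path : InducedPath G Inner
    inner-vertices-induce-path with any? (λ v → ¬? (Leaf? v))
    ... | no none = [] , [] , (λ v → mk⇔ (λ ()) (λ inner-v → ⊥-elim (none (v , inner-v)))) , λ _ _ ()
    ... | yes (s , inner-s) with maximal-extension n (inner-path s [] ([] ∷ []) [-] (inner-s ∷ [])) (m<m+n n (s≤s z≤n))
    ...   | P , maximal = vertices P , unique P ,
            (λ v → mk⇔ (All.lookup (inner P)) (maximal-covers P maximal v)) ,
            λ x y x∈ y∈ → mk⇔ (adjacent⇒consecutive prop (unique P) (linked P) x∈ y∈)
                              Sum.[ consecutive⇒adjacent (linked P) , Adj-sym ∘ consecutive⇒adjacent (linked P) ]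

  even-closed-subwalks⇒caterpillar : Connected G → EvenClosedSubwalkProperty G → Caterpillar G
  even-closed-subwalks⇒caterpillar conn prop = (conn , acyclic prop) , inner-vertices-induce-path conn prop

proposition9 : ∀ (n : ℕ) (G : Graph n) → Connected G →
    (Caterpillar G ⇔ EvenClosedSubwalkProperty G)
proposition9 n G conn = mk⇔ (caterpillar⇒even-closed-subwalks G conn) (even-closed-subwalks⇒caterpillar G conn)
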